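{- Let $s,r$ be non-negative integers and $\ell$ a prime. Let $R:=\mathrm{Mat}_{s\times s}(\mathbb{Z}_\ell)$ and view $M:=\mathrm{Mat}_{s\times r}(\mathbb{Z}_\ell)$ as a left $R$-module via matrix multiplication. Let $H$ be a closed subgroup of $\mathrm{GL}_s(\mathbb{Z}_\ell)$ and $V\subseteq M$ a closed left $H$-submodule. Let $W=R\cdot V$ be the $R$-submodule generated by $V$ and let $S$ denote the closed $\mathbb{Z}_\ell$-subalgebra of $R$ generated by $H$. Suppose that there are non-negative integers $n$ and $m$ such that (1) $W\supseteq \ell^n M$ and (2) $S\supseteq\ell^mR$. Then $V\supseteq \ell^{n+m}M$.
   Context: $M$ and $R$ carry the $\ell$-adic topology. A left $H$-submodule of $M$ is a subgroup of $M$ stable under left multiplication by elements of $H$. -}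

module Defs where

open import Data.Nat as ℕ using (ℕ; suc; _^_)
open import Data.Integer as ℤ using (ℤ; +_; _+_; _-_; _*_; -_; 0ℤ; 1ℤ)
open import Data.Integer.Divisibility.Signed
  using (_∣_; ∣m∣n⇒∣m+n; ∣m∣n⇒∣m-n; ∣m⇒∣-m; ∣n⇒∣m*n; ∣m⇒∣m*n; ∣-refl)
open import Data.Integer.Tactic.RingSolver using (solve-∀)
open import Data.Fin using (Fin; zero; suc; _≟_)
open import Relation.Nullary using (yes; no)
open import Data.Product using (Σ; _×_; _,_)
open import Relation.Binary.PropositionalEquality using (_≡_; subst; sym)
open import Level using (Level; 0ℓ) renaming (suc to lsuc)

-- The ℓ-adic integers ℤ_ℓ = lim ℤ/ℓ^k ℤ, represented by coherent
-- sequences of integer representatives: x k represents x mod ℓ^k and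
-- x (k+1) ≡ x k (mod ℓ^k).

record ℤₗ (ℓ : ℕ) : Set where
  constructor mkℤₗ
  field
    seq : ℕ → ℤ
    coh : ∀ k → (+ (ℓ ^ k)) ∣ (seq (suc k) - seq k)
open ℤₗ public

module _ {ℓ : ℕ} where

  _≡ₗ[_]_ : ℤₗ ℓ → ℕ → ℤₗ ℓ → Set
  x ≡ₗ[ k ] y = (+ (ℓ ^ k)) ∣ (seq x k - seq y k)

  _≈ₗ_ : ℤₗ ℓ → ℤₗ ℓ → Set
  x ≈ₗ y = ∀ k → x ≡ₗ[ k ] y

  private
    add-lem : ∀ a b c d → (a + b) - (c + d) ≡ (a - c) + (b - d)
    add-lem = solve-∀
    neg-lem : ∀ a c → (- a) - (- c) ≡ - (a - c)
    neg-lem = solve-∀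
    mul-lem : ∀ a b c d → (a * b) - (c * d) ≡ a * (b - d) + (a - c) * d
    mul-lem = solve-∀
    const-lem : ∀ a → a - a ≡ 0ℤ
    const-lem = solve-∀

  constₗ : ℤ → ℤₗ ℓ
  constₗ c = mkℤₗ (λ _ → c) (λ k → subst (_ ∣_) (sym (const-lem c)) (∣n⇒∣m*n 0ℤ ∣-refl))

  0ₗ 1ₗ : ℤₗ ℓ
  0ₗ = constₗ 0ℤ
  1ₗ = constₗ 1ℤ

  _+ₗ_ : ℤₗ ℓ → ℤₗ ℓ → ℤₗ ℓ
  x +ₗ y = mkℤₗ (λ k → seq x k + seq y k)
    (λ k → subst (_ ∣_) (sym (add-lem (seq x (suc k)) (seq y (suc k)) (seq x k) (seq y k)))
                 (∣m∣n⇒∣m+n (coh x k) (coh y k)))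

  -ₗ_ : ℤₗ ℓ → ℤₗ ℓ
  -ₗ x = mkℤₗ (λ k → - seq x k)
    (λ k → subst (_ ∣_) (sym (neg-lem (seq x (suc k)) (seq x k))) (∣m⇒∣-m (coh x k)))

  _*ₗ_ : ℤₗ ℓ → ℤₗ ℓ → ℤₗ ℓ
  x *ₗ y = mkℤₗ (λ k → seq x k * seq y k)
    (λ k → subst (_ ∣_) (sym (mul-lem (seq x (suc k)) (seq y (suc k)) (seq x k) (seq y k)))
                 (∣m∣n⇒∣m+n (∣n⇒∣m*n (seq x (suc k)) (coh y k)) (∣m⇒∣m*n (seq y k) (coh x k))))

Mat : ℕ → ℕ → ℕ → Set
Mat ℓ a b = Fin a → Fin b → ℤₗ ℓ

module _ {ℓ : ℕ} where

  Σₗ : ∀ {n} → (Fin n → ℤₗ ℓ) → ℤₗ ℓ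
  Σₗ {ℕ.zero} f = 0ₗ
  Σₗ {suc n} f = f zero +ₗ Σₗ (λ i → f (suc i))

  _≈ₘ_ : ∀ {a b} → Mat ℓ a b → Mat ℓ a b → Set
  X ≈ₘ Y = ∀ i j → X i j ≈ₗ Y i j

  -- entrywise congruence mod ℓ^k (the ℓ-adic topology on matrices)
  _≡ₘ[_]_ : ∀ {a b} → Mat ℓ a b → ℕ → Mat ℓ a b → Set
  X ≡ₘ[ k ] Y = ∀ i j → X i j ≡ₗ[ k ] Y i j

  0ₘ : ∀ {a b} → Mat ℓ a b
  0ₘ i j = 0ₗ

  Iₘ : ∀ {a} → Mat ℓ a a
  Iₘ i j with i ≟ j
  ... | yes _ = 1ₗ
  ... | no _ = 0ₗ

  _+ₘ_ : ∀ {a b} → Mat ℓ a b → Mat ℓ a b → Mat ℓ a b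
  (X +ₘ Y) i j = X i j +ₗ Y i j

  -ₘ_ : ∀ {a b} → Mat ℓ a b → Mat ℓ a b
  (-ₘ X) i j = -ₗ X i j

  _*ₘ_ : ∀ {a b c} → Mat ℓ a b → Mat ℓ b c → Mat ℓ a c
  (X *ₘ Y) i j = Σₗ (λ t → X i t *ₗ Y t j)

  _•ₘ_ : ∀ {a b} → ℤₗ ℓ → Mat ℓ a b → Mat ℓ a b
  (c •ₘ X) i j = c *ₗ X i j

  ℓ^ : ℕ → ℤₗ ℓ
  ℓ^ n = constₗ (+ (ℓ ^ n))

  IsClosed : ∀ {a b} → (Mat ℓ a b → Set) → Set
  IsClosed {a} {b} P =
    ∀ (X : Mat ℓ a b) → (∀ k → Σ (Mat ℓ a b) (λ Y → P Y × Y ≡ₘ[ k ] X)) → P X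

  InGL : ∀ {s} → Mat ℓ s s → Set
  InGL {s} A = Σ (Mat ℓ s s) (λ B → (A *ₘ B) ≈ₘ Iₘ × (B *ₘ A) ≈ₘ Iₘ)

  record IsClosedSubgroupGL {s} (H : Mat ℓ s s → Set) : Set where
    field
      inGL    : ∀ A → H A → InGL A
      closed  : IsClosed H
      has-I   : H Iₘ
      mul     : ∀ A B → H A → H B → H (A *ₘ B)
      inv     : ∀ A B → H A → (A *ₘ B) ≈ₘ Iₘ → (B *ₘ A) ≈ₘ Iₘ → H B

  record IsClosedHSubmodule {s r} (H : Mat ℓ s s → Set) (V : Mat ℓ s r → Set) : Set where
    field
      closed : IsClosed V
      has-0  : V 0ₘ
      add    : ∀ x y → V x → V y → V (x +ₘ y)
      neg    : ∀ x → V x → V (-ₘ x)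
      act    : ∀ A x → H A → V x → V (A *ₘ x)

  record IsRSubmodule {s r} (P : Mat ℓ s r → Set) : Set where
    field
      resp  : ∀ x y → x ≈ₘ y → P x → P y
      has-0 : P 0ₘ
      add   : ∀ x y → P x → P y → P (x +ₘ y)
      neg   : ∀ x → P x → P (-ₘ x)
      act   : ∀ (A : Mat ℓ s s) x → P x → P (A *ₘ x)

  RSpan : ∀ {s r} → (Mat ℓ s r → Set) → Mat ℓ s r → Set₁
  RSpan {s} {r} V x =
    ∀ (P : Mat ℓ s r → Set) → IsRSubmodule P → (∀ v → V v → P v) → P x

  record IsClosedSubalgebra {s} (Q : Mat ℓ s s → Set) : Set where
    field
      closed : IsClosed Q
      has-I  : Q Iₘ
      add    : ∀ A B → Q A → Q B → Q (A +ₘ B)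
      neg    : ∀ A → Q A → Q (-ₘ A)
      mul    : ∀ A B → Q A → Q B → Q (A *ₘ B)
      smul   : ∀ (c : ℤₗ ℓ) A → Q A → Q (c •ₘ A)

  ClosedAlgSpan : ∀ {s} → (Mat ℓ s s → Set) → Mat ℓ s s → Set₁
  ClosedAlgSpan {s} H A =
    ∀ (Q : Mat ℓ s s → Set) → IsClosedSubalgebra Q → (∀ h → H h → Q h) → Q A

-- The stabiliser Q = { A ∈ R | A V ⊆ V } of V is a closed subalgebra of R
-- containing H, so it contains S and hence ℓ^m R.  Consequently the colon
-- module (V : ℓ^m R) = { y | ℓ^m R y ⊆ V } is an R-submodule containing V,
-- so it contains W ⊇ ℓ^n M, which gives ℓ^m ℓ^n M ⊆ V.
module Submission where

open import Defs
open import Data.Nat using (ℕ; _+_)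
open import Data.Nat.Primality using (Prime)
import Data.Nat as ℕ
import Data.Nat.Properties as ℕP
open import Data.Integer as ℤ using (ℤ; +_; -[1+_]; 0ℤ; 1ℤ; -1ℤ)
import Data.Integer.Properties as ℤP
open import Data.Integer.Divisibility.Signed using (_∣_; ∣-refl; ∣n⇒∣m*n; ∣m⇒∣m*n; ∣m∣n⇒∣m+n)
open import Data.Integer.Tactic.RingSolver using (solve-∀)
open import Algebra.Properties.Semiring.Sum ℤP.+-*-semiring
  using (sum; sum-cong-≗; sum-replicate-zero; ∑-distrib-+; ∑-comm; *-distribˡ-sum; *-distribʳ-sum)
open import Algebra.Properties.Ring ℤP.+-*-ring using ([y-z]x≈yx-zx; x[y-z]≈xy-xz)
open import Data.Fin using (Fin; zero; suc; _≟_)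
open import Data.Product using (_,_)
open import Function using (_∘_)
open import Relation.Nullary using (yes; no)
open import Relation.Binary.PropositionalEquality

sum-neg : ∀ {n} (f : Fin n → ℤ) → sum (λ t → ℤ.- f t) ≡ ℤ.- sum f
sum-neg f = begin
  sum (λ t → ℤ.- f t)      ≡⟨ sum-cong-≗ (λ t → sym (ℤP.-1*i≡-i (f t))) ⟩
  sum (λ t → -1ℤ ℤ.* f t)  ≡⟨ sym (*-distribˡ-sum -1ℤ f) ⟩
  -1ℤ ℤ.* sum f            ≡⟨ ℤP.-1*i≡-i (sum f) ⟩
  ℤ.- sum f                ∎
  where open ≡-Reasoning

∣-refl-sub : ∀ d {a b} → a ≡ b → d ∣ a ℤ.- b
∣-refl-sub d {a} refl = subst (d ∣_) (sym (ℤP.i≡j⇒i-j≡0 {a} refl)) (∣n⇒∣m*n 0ℤ ∣-refl)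

sum-cong-∣ : ∀ {n} d (f g : Fin n → ℤ) → (∀ t → d ∣ f t ℤ.- g t) → d ∣ sum f ℤ.- sum g
sum-cong-∣ {ℕ.zero}  d f g _ = ∣-refl-sub d {0ℤ} refl
sum-cong-∣ {ℕ.suc n} d f g f≡g =
  subst (d ∣_) (sym (regroup (f zero) (g zero) (sum (f ∘ suc)) (sum (g ∘ suc))))
  (∣m∣n⇒∣m+n (f≡g zero) (sum-cong-∣ d (f ∘ suc) (g ∘ suc) (f≡g ∘ suc)))
  where
  regroup : ∀ a b c e → (a ℤ.+ c) ℤ.- (b ℤ.+ e) ≡ (a ℤ.- b) ℤ.+ (c ℤ.- e)
  regroup = solve-∀

module _ {ℓ : ℕ} where

  rep : ∀ {a b} → ℕ → Mat ℓ a b → Fin a → Fin b → ℤ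
  rep k X i j = seq (X i j) k

  -- Levelwise equality of representatives (stronger than _≈ₘ_); a record so
  -- that X and Y stay inferable.
  record _≗ₘ_ {a b} (X Y : Mat ℓ a b) : Set where
    field entry≡ : ∀ i j k → rep k X i j ≡ rep k Y i j
  open _≗ₘ_

  ≗ₘ-sym : ∀ {a b} {X Y : Mat ℓ a b} → X ≗ₘ Y → Y ≗ₘ X
  ≗ₘ-sym X≗Y .entry≡ i j k = sym (X≗Y .entry≡ i j k)

  ≗ₘ-trans : ∀ {a b} {X Y Z : Mat ℓ a b} → X ≗ₘ Y → Y ≗ₘ Z → X ≗ₘ Z
  ≗ₘ-trans X≗Y Y≗Z .entry≡ i j k = trans (X≗Y .entry≡ i j k) (Y≗Z .entry≡ i j k)

  ≗ₘ⇒≈ₘ : ∀ {a b} {X Y : Mat ℓ a b} → X ≗ₘ Y → X ≈ₘ Y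
  ≗ₘ⇒≈ₘ X≗Y i j k = ∣-refl-sub _ (X≗Y .entry≡ i j k)

  closed-resp-≈ₘ : ∀ {a b} {P : Mat ℓ a b → Set} → IsClosed P → ∀ {X Y} → X ≈ₘ Y → P X → P Y
  closed-resp-≈ₘ closed {X} X≈Y PX = closed _ (λ k → X , PX , λ i j → X≈Y i j k)

  closed-resp-≗ₘ : ∀ {a b} {P : Mat ℓ a b → Set} → IsClosed P → ∀ {X Y} → X ≗ₘ Y → P X → P Y
  closed-resp-≗ₘ closed X≗Y = closed-resp-≈ₘ closed (≗ₘ⇒≈ₘ X≗Y)

  seq-Σₗ : ∀ {n} k (f : Fin n → ℤₗ ℓ) → seq (Σₗ f) k ≡ sum (λ t → seq (f t) k)
  seq-Σₗ {ℕ.zero}  k f = refl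
  seq-Σₗ {ℕ.suc n} k f = cong (ℤ._+_ (seq (f zero) k)) (seq-Σₗ k (f ∘ suc))

  rep-*ₘ : ∀ {a b c} k (X : Mat ℓ a b) (Y : Mat ℓ b c) i j →
           rep k (X *ₘ Y) i j ≡ sum (λ t → rep k X i t ℤ.* rep k Y t j)
  rep-*ₘ k X Y i j = seq-Σₗ k (λ t → X i t *ₗ Y t j)

  Iₘ-suc : ∀ {a} (i t : Fin a) → Iₘ {ℓ} (suc i) (suc t) ≡ Iₘ i t
  Iₘ-suc i t with i ≟ t
  ... | yes _ = refl
  ... | no _  = refl

  sum-Iₘ-* : ∀ {a} k (i : Fin a) (f : Fin a → ℤ) → sum (λ t → rep k Iₘ i t ℤ.* f t) ≡ f i
  sum-Iₘ-* {ℕ.suc a} k zero f = begin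
    1ℤ ℤ.* f zero ℤ.+ sum (λ t → 0ℤ ℤ.* f (suc t))
      ≡⟨ cong₂ ℤ._+_ (ℤP.*-identityˡ (f zero))
                    (trans (sum-cong-≗ {y = λ _ → 0ℤ} (ℤP.*-zeroˡ ∘ f ∘ suc)) (sum-replicate-zero a)) ⟩
    f zero ℤ.+ 0ℤ
      ≡⟨ ℤP.+-identityʳ _ ⟩
    f zero ∎
    where open ≡-Reasoning
  sum-Iₘ-* {ℕ.suc a} k (suc i) f = begin
    0ℤ ℤ.* f zero ℤ.+ sum (λ t → rep k Iₘ (suc i) (suc t) ℤ.* f (suc t))
      ≡⟨ cong₂ ℤ._+_ (ℤP.*-zeroˡ (f zero))
                    (sum-cong-≗ (λ t → cong (λ e → seq e k ℤ.* f (suc t)) (Iₘ-suc i t))) ⟩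
    0ℤ ℤ.+ sum (λ t → rep k Iₘ i t ℤ.* f (suc t))
      ≡⟨ ℤP.+-identityˡ _ ⟩
    sum (λ t → rep k Iₘ i t ℤ.* f (suc t))
      ≡⟨ sum-Iₘ-* k i (f ∘ suc) ⟩
    f (suc i) ∎
    where open ≡-Reasoning

  *ₘ-congʳ : ∀ {a b c} {X X' : Mat ℓ a b} (Y : Mat ℓ b c) → X ≗ₘ X' → (X *ₘ Y) ≗ₘ (X' *ₘ Y)
  *ₘ-congʳ {X = X} {X'} Y X≗X' .entry≡ i j k = begin
    rep k (X *ₘ Y) i j
      ≡⟨ rep-*ₘ k X Y i j ⟩
    sum (λ t → rep k X i t ℤ.* rep k Y t j)
      ≡⟨ sum-cong-≗ (λ t → cong (λ e → e ℤ.* rep k Y t j) (X≗X' .entry≡ i t k)) ⟩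
    sum (λ t → rep k X' i t ℤ.* rep k Y t j)
      ≡⟨ sym (rep-*ₘ k X' Y i j) ⟩
    rep k (X' *ₘ Y) i j ∎
    where open ≡-Reasoning

  *ₘ-assoc : ∀ {a b c d} (X : Mat ℓ a b) (Y : Mat ℓ b c) (Z : Mat ℓ c d) →
             ((X *ₘ Y) *ₘ Z) ≗ₘ (X *ₘ (Y *ₘ Z))
  *ₘ-assoc X Y Z .entry≡ i j k = begin
    rep k ((X *ₘ Y) *ₘ Z) i j
      ≡⟨ rep-*ₘ k (X *ₘ Y) Z i j ⟩
    sum (λ u → rep k (X *ₘ Y) i u ℤ.* z u)
      ≡⟨ sum-cong-≗ (λ u → cong (λ e → e ℤ.* z u) (rep-*ₘ k X Y i u)) ⟩
    sum (λ u → sum (λ t → x t ℤ.* y t u) ℤ.* z u)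
      ≡⟨ sum-cong-≗ (λ u → *-distribʳ-sum (z u) (λ t → x t ℤ.* y t u)) ⟩
    sum (λ u → sum (λ t → x t ℤ.* y t u ℤ.* z u))
      ≡⟨ ∑-comm (λ u t → x t ℤ.* y t u ℤ.* z u) ⟩
    sum (λ t → sum (λ u → x t ℤ.* y t u ℤ.* z u))
      ≡⟨ sum-cong-≗ (λ t → sum-cong-≗ (λ u → ℤP.*-assoc (x t) (y t u) (z u))) ⟩
    sum (λ t → sum (λ u → x t ℤ.* (y t u ℤ.* z u)))
      ≡⟨ sum-cong-≗ (λ t → sym (*-distribˡ-sum (x t) (λ u → y t u ℤ.* z u))) ⟩
    sum (λ t → x t ℤ.* sum (λ u → y t u ℤ.* z u))
      ≡⟨ sum-cong-≗ (λ t → cong (x t ℤ.*_) (sym (rep-*ₘ k Y Z t j))) ⟩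
    sum (λ t → x t ℤ.* rep k (Y *ₘ Z) t j)
      ≡⟨ sym (rep-*ₘ k X (Y *ₘ Z) i j) ⟩
    rep k (X *ₘ (Y *ₘ Z)) i j ∎
    where
    open ≡-Reasoning
    x = rep k X i
    y = rep k Y
    z = λ u → rep k Z u j

  *ₘ-identityˡ : ∀ {a b} (X : Mat ℓ a b) → (Iₘ *ₘ X) ≗ₘ X
  *ₘ-identityˡ X .entry≡ i j k = trans (rep-*ₘ k Iₘ X i j) (sum-Iₘ-* k i (λ t → rep k X t j))

  *ₘ-zeroʳ : ∀ {a b c} (X : Mat ℓ a b) → (X *ₘ 0ₘ {b = c}) ≗ₘ 0ₘ
  *ₘ-zeroʳ {b = b} X .entry≡ i j k = begin
    rep k (X *ₘ 0ₘ) i j              ≡⟨ rep-*ₘ k X 0ₘ i j ⟩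
    sum (λ t → rep k X i t ℤ.* 0ℤ)   ≡⟨ sum-cong-≗ (ℤP.*-zeroʳ ∘ rep k X i) ⟩
    sum {b} (λ _ → 0ℤ)               ≡⟨ sum-replicate-zero b ⟩
    0ℤ                               ∎
    where open ≡-Reasoning

  *ₘ-distribˡ-+ₘ : ∀ {a b c} (X : Mat ℓ a b) (Y Z : Mat ℓ b c) → (X *ₘ (Y +ₘ Z)) ≗ₘ ((X *ₘ Y) +ₘ (X *ₘ Z))
  *ₘ-distribˡ-+ₘ X Y Z .entry≡ i j k = begin
    rep k (X *ₘ (Y +ₘ Z)) i j
      ≡⟨ rep-*ₘ k X (Y +ₘ Z) i j ⟩
    sum (λ t → x t ℤ.* (y t ℤ.+ z t))
      ≡⟨ sum-cong-≗ (λ t → ℤP.*-distribˡ-+ (x t) (y t) (z t)) ⟩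
    sum (λ t → x t ℤ.* y t ℤ.+ x t ℤ.* z t)
      ≡⟨ ∑-distrib-+ (λ t → x t ℤ.* y t) (λ t → x t ℤ.* z t) ⟩
    sum (λ t → x t ℤ.* y t) ℤ.+ sum (λ t → x t ℤ.* z t)
      ≡⟨ sym (cong₂ ℤ._+_ (rep-*ₘ k X Y i j) (rep-*ₘ k X Z i j)) ⟩
    rep k ((X *ₘ Y) +ₘ (X *ₘ Z)) i j ∎
    where
    open ≡-Reasoning
    x = rep k X i
    y = λ t → rep k Y t j
    z = λ t → rep k Z t j

  *ₘ-distribʳ-+ₘ : ∀ {a b c} (X Y : Mat ℓ a b) (Z : Mat ℓ b c) → ((X +ₘ Y) *ₘ Z) ≗ₘ ((X *ₘ Z) +ₘ (Y *ₘ Z))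
  *ₘ-distribʳ-+ₘ X Y Z .entry≡ i j k = begin
    rep k ((X +ₘ Y) *ₘ Z) i j
      ≡⟨ rep-*ₘ k (X +ₘ Y) Z i j ⟩
    sum (λ t → (x t ℤ.+ y t) ℤ.* z t)
      ≡⟨ sum-cong-≗ (λ t → ℤP.*-distribʳ-+ (z t) (x t) (y t)) ⟩
    sum (λ t → x t ℤ.* z t ℤ.+ y t ℤ.* z t)
      ≡⟨ ∑-distrib-+ (λ t → x t ℤ.* z t) (λ t → y t ℤ.* z t) ⟩
    sum (λ t → x t ℤ.* z t) ℤ.+ sum (λ t → y t ℤ.* z t)
      ≡⟨ sym (cong₂ ℤ._+_ (rep-*ₘ k X Z i j) (rep-*ₘ k Y Z i j)) ⟩
    rep k ((X *ₘ Z) +ₘ (Y *ₘ Z)) i j ∎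
    where
    open ≡-Reasoning
    x = rep k X i
    y = rep k Y i
    z = λ t → rep k Z t j

  neg-distribˡ-*ₘ : ∀ {a b c} (X : Mat ℓ a b) (Y : Mat ℓ b c) → (-ₘ (X *ₘ Y)) ≗ₘ ((-ₘ X) *ₘ Y)
  neg-distribˡ-*ₘ X Y .entry≡ i j k = begin
    ℤ.- rep k (X *ₘ Y) i j               ≡⟨ cong ℤ.-_ (rep-*ₘ k X Y i j) ⟩
    ℤ.- sum (λ t → x t ℤ.* y t)          ≡⟨ sym (sum-neg (λ t → x t ℤ.* y t)) ⟩
    sum (λ t → ℤ.- (x t ℤ.* y t))        ≡⟨ sum-cong-≗ (λ t → ℤP.neg-distribˡ-* (x t) (y t)) ⟩
    sum (λ t → (ℤ.- x t) ℤ.* y t)        ≡⟨ sym (rep-*ₘ k (-ₘ X) Y i j) ⟩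
    rep k ((-ₘ X) *ₘ Y) i j              ∎
    where
    open ≡-Reasoning
    x = rep k X i
    y = λ t → rep k Y t j

  neg-distribʳ-*ₘ : ∀ {a b c} (X : Mat ℓ a b) (Y : Mat ℓ b c) → (-ₘ (X *ₘ Y)) ≗ₘ (X *ₘ (-ₘ Y))
  neg-distribʳ-*ₘ X Y .entry≡ i j k = begin
    ℤ.- rep k (X *ₘ Y) i j               ≡⟨ cong ℤ.-_ (rep-*ₘ k X Y i j) ⟩
    ℤ.- sum (λ t → x t ℤ.* y t)          ≡⟨ sym (sum-neg (λ t → x t ℤ.* y t)) ⟩
    sum (λ t → ℤ.- (x t ℤ.* y t))        ≡⟨ sum-cong-≗ (λ t → ℤP.neg-distribʳ-* (x t) (y t)) ⟩
    sum (λ t → x t ℤ.* ℤ.- y t)          ≡⟨ sym (rep-*ₘ k X (-ₘ Y) i j) ⟩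
    rep k (X *ₘ (-ₘ Y)) i j              ∎
    where
    open ≡-Reasoning
    x = rep k X i
    y = λ t → rep k Y t j

  •ₘ-*ₘ-assoc : ∀ {a b c} (e : ℤₗ ℓ) (X : Mat ℓ a b) (Y : Mat ℓ b c) → ((e •ₘ X) *ₘ Y) ≗ₘ (e •ₘ (X *ₘ Y))
  •ₘ-*ₘ-assoc e X Y .entry≡ i j k = begin
    rep k ((e •ₘ X) *ₘ Y) i j              ≡⟨ rep-*ₘ k (e •ₘ X) Y i j ⟩
    sum (λ t → seq e k ℤ.* x t ℤ.* y t)    ≡⟨ sum-cong-≗ (λ t → ℤP.*-assoc (seq e k) (x t) (y t)) ⟩
    sum (λ t → seq e k ℤ.* (x t ℤ.* y t))  ≡⟨ sym (*-distribˡ-sum (seq e k) (λ t → x t ℤ.* y t)) ⟩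
    seq e k ℤ.* sum (λ t → x t ℤ.* y t)    ≡⟨ cong (seq e k ℤ.*_) (sym (rep-*ₘ k X Y i j)) ⟩
    rep k (e •ₘ (X *ₘ Y)) i j              ∎
    where
    open ≡-Reasoning
    x = rep k X i
    y = λ t → rep k Y t j

  *ₘ-congʳ-mod : ∀ {a b c} k {X X' : Mat ℓ a b} (Y : Mat ℓ b c) → X ≡ₘ[ k ] X' → (X *ₘ Y) ≡ₘ[ k ] (X' *ₘ Y)
  *ₘ-congʳ-mod k {X} {X'} Y X≡X' i j =
    subst₂ (λ u v → _ ∣ u ℤ.- v) (sym (rep-*ₘ k X Y i j)) (sym (rep-*ₘ k X' Y i j))
      (sum-cong-∣ _ _ _ λ t →
        subst (_ ∣_) ([y-z]x≈yx-zx (rep k Y t j) (rep k X i t) (rep k X' i t))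
              (∣m⇒∣m*n (rep k Y t j) (X≡X' i t)))

  *ₘ-congˡ-mod : ∀ {a b c} k (X : Mat ℓ a b) {Y Y' : Mat ℓ b c} → Y ≡ₘ[ k ] Y' → (X *ₘ Y) ≡ₘ[ k ] (X *ₘ Y')
  *ₘ-congˡ-mod k X {Y} {Y'} Y≡Y' i j =
    subst₂ (λ u v → _ ∣ u ℤ.- v) (sym (rep-*ₘ k X Y i j)) (sym (rep-*ₘ k X Y' i j))
      (sum-cong-∣ _ _ _ λ t →
        subst (_ ∣_) (x[y-z]≈xy-xz (rep k X i t) (rep k Y t j) (rep k Y' t j))
              (∣n⇒∣m*n (rep k X i t) (Y≡Y' t j)))

  ℓ^-•ₘ-•ₘ : ∀ {a b} m n (X : Mat ℓ a b) → (ℓ^ m •ₘ (ℓ^ n •ₘ X)) ≗ₘ (ℓ^ (n + m) •ₘ X)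
  ℓ^-•ₘ-•ₘ m n X .entry≡ i j k = begin
    + (ℓ ℕ.^ m) ℤ.* (+ (ℓ ℕ.^ n) ℤ.* x)    ≡⟨ sym (ℤP.*-assoc (+ (ℓ ℕ.^ m)) _ x) ⟩
    + (ℓ ℕ.^ m) ℤ.* + (ℓ ℕ.^ n) ℤ.* x      ≡⟨ cong (ℤ._* x) (sym (ℤP.pos-* (ℓ ℕ.^ m) (ℓ ℕ.^ n))) ⟩
    + (ℓ ℕ.^ m ℕ.* ℓ ℕ.^ n) ℤ.* x          ≡⟨ cong (λ e → + e ℤ.* x) ℓ^m*ℓ^n≡ℓ^[n+m] ⟩
    + (ℓ ℕ.^ (n + m)) ℤ.* x                ∎
    where
    open ≡-Reasoning
    x = rep k X i j
    ℓ^m*ℓ^n≡ℓ^[n+m] : ℓ ℕ.^ m ℕ.* ℓ ℕ.^ n ≡ ℓ ℕ.^ (n + m)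
    ℓ^m*ℓ^n≡ℓ^[n+m] = trans (ℕP.*-comm (ℓ ℕ.^ m) _) (sym (ℕP.^-distribˡ-+-* ℓ n m))

  Stabilizer : ∀ {s r} → (Mat ℓ s r → Set) → Mat ℓ s s → Set
  Stabilizer V A = ∀ v → V v → V (A *ₘ v)

  Colon : ∀ {s r} → ℤₗ ℓ → (Mat ℓ s r → Set) → Mat ℓ s r → Set
  Colon c V y = ∀ A → V ((c •ₘ A) *ₘ y)

  module _ {s r} {H : Mat ℓ s s → Set} {V : Mat ℓ s r → Set} (isV : IsClosedHSubmodule H V) where
    open IsClosedHSubmodule isV

    V-resp : ∀ {x y} → x ≗ₘ y → V x → V y
    V-resp = closed-resp-≗ₘ closed

    ℕ-multiple-closed : ∀ n {w} → V w → V (constₗ (+ n) •ₘ w)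
    ℕ-multiple-closed ℕ.zero {w} _ =
      V-resp (λ where .entry≡ i j k → sym (ℤP.*-zeroˡ (rep k w i j))) has-0
    ℕ-multiple-closed (ℕ.suc n) {w} Vw =
      V-resp (λ where .entry≡ i j k → sym (ℤP.suc-* (+ n) (rep k w i j)))
             (add w _ Vw (ℕ-multiple-closed n Vw))

    ℤ-multiple-closed : ∀ z {w} → V w → V (constₗ z •ₘ w)
    ℤ-multiple-closed (+ n)    = ℕ-multiple-closed n
    ℤ-multiple-closed -[1+ n ] {w} Vw =
      V-resp (λ where .entry≡ i j k → ℤP.neg-distribˡ-* (+ ℕ.suc n) (rep k w i j))
             (neg _ (ℕ-multiple-closed (ℕ.suc n) Vw))

    -- At level k the scalar c is indistinguishable from the integer seq c k.
    •ₘ-closed : ∀ c {w} → V w → V (c •ₘ w)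
    •ₘ-closed c {w} Vw = closed (c •ₘ w) λ k →
      constₗ (seq c k) •ₘ w , ℤ-multiple-closed (seq c k) Vw ,
      λ i j → ∣-refl-sub _ {rep k (c •ₘ w) i j} refl

    stabilizer-isClosedSubalgebra : IsClosedSubalgebra (Stabilizer V)
    stabilizer-isClosedSubalgebra = record
      { closed = λ A approx v Vv → closed (A *ₘ v) λ k →
          let (B , B∈Q , B≡A) = approx k in B *ₘ v , B∈Q v Vv , *ₘ-congʳ-mod k {B} {A} v B≡A
      ; has-I  = λ v Vv → V-resp (≗ₘ-sym (*ₘ-identityˡ v)) Vv
      ; add    = λ A B A∈Q B∈Q v Vv →
          V-resp (≗ₘ-sym (*ₘ-distribʳ-+ₘ A B v)) (add _ _ (A∈Q v Vv) (B∈Q v Vv))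
      ; neg    = λ A A∈Q v Vv → V-resp (neg-distribˡ-*ₘ A v) (neg _ (A∈Q v Vv))
      ; mul    = λ A B A∈Q B∈Q v Vv → V-resp (≗ₘ-sym (*ₘ-assoc A B v)) (A∈Q _ (B∈Q v Vv))
      ; smul   = λ c A A∈Q v Vv → V-resp (≗ₘ-sym (•ₘ-*ₘ-assoc c A v)) (•ₘ-closed c (A∈Q v Vv))
      }

    ClosedAlgSpan⊆Stabilizer : ∀ A → ClosedAlgSpan H A → Stabilizer V A
    ClosedAlgSpan⊆Stabilizer _ A∈S =
      A∈S (Stabilizer V) stabilizer-isClosedSubalgebra (λ h h∈H v Vv → act h v h∈H Vv)

    colon-isRSubmodule : ∀ c → IsRSubmodule (Colon c V)
    colon-isRSubmodule c = record
      { resp  = λ x y x≈y x∈P A →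
          closed-resp-≈ₘ closed (λ i j k → *ₘ-congˡ-mod k (c •ₘ A) {x} {y} (λ i′ j′ → x≈y i′ j′ k) i j)
                         (x∈P A)
      ; has-0 = λ A → V-resp (≗ₘ-sym (*ₘ-zeroʳ (c •ₘ A))) has-0
      ; add   = λ x y x∈P y∈P A → V-resp (≗ₘ-sym (*ₘ-distribˡ-+ₘ (c •ₘ A) x y)) (add _ _ (x∈P A) (y∈P A))
      ; neg   = λ x x∈P A → V-resp (neg-distribʳ-*ₘ (c •ₘ A) x) (neg _ (x∈P A))
      ; act   = λ B x x∈P A →
          V-resp (≗ₘ-trans (*ₘ-congʳ x (≗ₘ-sym (•ₘ-*ₘ-assoc c A B))) (*ₘ-assoc (c •ₘ A) B x))
                 (x∈P (A *ₘ B))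
      }

    scaled-RSpan⊆ : ∀ c y → (∀ A → Stabilizer V (c •ₘ A)) → RSpan V y → V (c •ₘ y)
    scaled-RSpan⊆ c y cR⊆Q y∈W = V-resp cI*y≗c•y (y∈W (Colon c V) (colon-isRSubmodule c) V⊆P Iₘ)
      where
      V⊆P : ∀ v → V v → Colon c V v
      V⊆P v Vv A = cR⊆Q A v Vv
      cI*y≗c•y : ((c •ₘ Iₘ) *ₘ y) ≗ₘ (c •ₘ y)
      cI*y≗c•y = ≗ₘ-trans (•ₘ-*ₘ-assoc c Iₘ y)
        (λ where .entry≡ i j k → cong (seq c k ℤ.*_) (*ₘ-identityˡ y .entry≡ i j k))

proposition4p3 : (s r ℓ : ℕ) → Prime ℓ →
    (H : Mat ℓ s s → Set) → IsClosedSubgroupGL H →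
    (V : Mat ℓ s r → Set) → IsClosedHSubmodule H V →
    (n m : ℕ) →
    (∀ (x : Mat ℓ s r) → RSpan V (ℓ^ n •ₘ x)) →
    (∀ (A : Mat ℓ s s) → ClosedAlgSpan H (ℓ^ m •ₘ A)) →
    ∀ (x : Mat ℓ s r) → V (ℓ^ (n + m) •ₘ x)
proposition4p3 _ _ _ _ _ _ V isV n m W⊇ℓⁿM S⊇ℓᵐR x =
  V-resp isV (ℓ^-•ₘ-•ₘ m n x) (scaled-RSpan⊆ isV (ℓ^ m) (ℓ^ n •ₘ x) ℓᵐR⊆Q (W⊇ℓⁿM x))
  where
  ℓᵐR⊆Q : ∀ A → Stabilizer V (ℓ^ m •ₘ A)
  ℓᵐR⊆Q A = ClosedAlgSpan⊆Stabilizer isV (ℓ^ m •ₘ A) (S⊇ℓᵐR A)
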